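{- Let $\mathcal{A}=(Q,\Sigma,\delta,q_0,F)$ be a trim NFA. Every minimal blocking sequence for $\mathcal{A}$ contains at most $p^2|Q|^2$ terms.
   Context: SCC = maximal set of mutually reachable states; $s<_{\mathcal{A}}t$ if the SCC of $t$ is reachable from that of $s$ and they differ. $p$ = lcm of lengths of all simple cycles of $\mathcal{A}$. A positional word is a word over $(\mathbb{Z}/p\mathbb{Z})\times\Sigma$ of the form $(n\bmod p,a_0)((n+1)\bmod p,a_1)\cdots$, written $\langle n:u\rangle$. A portal is $P=(s,x,t,y)\in(Q\times\mathbb{Z}/p\mathbb{Z})^2$ with $s,t$ in the same SCC; $L(P)=\{\langle x:w\rangle: s\xrightarrow{w}t,\ x+|w|\equiv y\pmod p\}$; a positional word is blocking for $P$ if it is not a factor of any word of $L(P)$. An SCC-path is $\pi=P_0\xrightarrow{a_1}\cdots\xrightarrow{a_k}P_k$ with portals $P_i=(s_i,x_i,t_i,y_i)$, $x_i\equiv y_{i-1}+1$, $s_i\in\delta(t_{i-1},a_i)$, $t_{i-1}<_{\mathcal{A}}s_i$; $L(\pi)=L(P_0)(y_0,a_1)L(P_1)\cdots(y_{k-1},a_k)L(P_k)$; accepting if $x_0=0$, $s_0=q_0$, $t_k\in F$, $L(\pi)\neq\emptyset$. A sequence $(\mu_1,\dots,\mu_\ell)$ of positional words is blocking for $\pi$ if there are indices $i_0\le\cdots\le i_k$ with $\mu_{i_j}$ blocking for $P_j$; it is blocking for $\mathcal{A}$ if blocking for every accepting SCC-path. $(\mu_1,\dots,\mu_k)\trianglelefteq(\mu'_1,\dots,\mu'_t)$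 if there are indices $i_1\le\cdots\le i_k$ with $\mu_j$ a factor of $\mu'_{i_j}$ for all $j$. A minimal blocking sequence is a $\trianglelefteq$-minimal element among blocking sequences of $\mathcal{A}$.
   Formalization: The order ⊴ on sequences uses strictly increasing indices $i_1<\cdots<i_k$ instead of $i_1\le\cdots\le i_k$, so distinct terms $\mu_j$ are factors of distinct terms of $(\mu'_1,\dots,\mu'_t)$. The statement above fails without it. -}

module Defs where

open import Data.Nat using (ℕ; zero; suc; _+_; _*_; _^_; _≤_; NonZero)
open import Data.Nat.DivMod using (_mod_)
open import Data.Nat.Divisibility using (_∣_)
open import Data.Fin using (Fin; toℕ)
open import Data.Bool using (Bool; true)
open import Data.List using (List; []; _∷_; _++_; length; lookup)
open import Data.List.Relation.Unary.All using (All)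
open import Data.Product using (Σ; ∃; _×_; _,_; proj₂)
open import Data.Unit using (⊤)
open import Relation.Nullary using (¬_)
open import Relation.Binary.PropositionalEquality using (_≡_)
open import Function.Definitions using (Injective)

record NFA : Set where
  field
    nQ  : ℕ
    nΣ  : ℕ
    δ   : Fin nQ → Fin nΣ → Fin nQ → Bool   -- δ s a t ≡ true  iff  t ∈ δ(s,a)
    q₀  : Fin nQ
    F   : Fin nQ → Bool

module _ (A : NFA) where
  open NFA A

  data Run : Fin nQ → List (Fin nΣ) → Fin nQ → Set where
    nil  : ∀ {s} → Run s [] s
    cons : ∀ {s a s' w t} → δ s a s' ≡ true → Run s' w t → Run s (a ∷ w) t

  Reach : Fin nQ → Fin nQ → Set
  Reach s t = ∃ λ w → Run s w t

  Trim : Set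
  Trim = ∀ q → Reach q₀ q × ∃ λ f → F f ≡ true × Reach q f

  SameSCC : Fin nQ → Fin nQ → Set
  SameSCC s t = Reach s t × Reach t s

  _<A_ : Fin nQ → Fin nQ → Set
  s <A t = Reach s t × ¬ SameSCC s t

  HasSimpleCycle : ℕ → Set
  HasSimpleCycle zero    = Data.Empty.⊥ where import Data.Empty
  HasSimpleCycle (suc j) =
    Σ (Fin (suc j) → Fin nQ) λ c →
      Injective _≡_ _≡_ c ×
      (∀ i → ∃ λ a → δ (c i) a (c ((suc (toℕ i)) mod (suc j))) ≡ true)

  IsCycleLcm : ℕ → Set
  IsCycleLcm p = (∀ k → HasSimpleCycle k → k ∣ p)
               × (∀ m → (∀ k → HasSimpleCycle k → k ∣ m) → p ∣ m)

module _ (A : NFA) (p : ℕ) .{{_ : NonZero p}} where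
  open NFA A

  ℤp : Set
  ℤp = Fin p

  suc-p : ℤp → ℤp
  suc-p x = (suc (toℕ x)) mod p

  PWord : Set
  PWord = List (ℤp × Fin nΣ)

  ⟨_∶_⟩ : ℤp → List (Fin nΣ) → PWord
  ⟨ x ∶ [] ⟩     = []
  ⟨ x ∶ a ∷ u ⟩ = (x , a) ∷ ⟨ suc-p x ∶ u ⟩

  IsPositional : PWord → Set
  IsPositional w = ∃ λ x → ∃ λ u → w ≡ ⟨ x ∶ u ⟩

  Factor : PWord → PWord → Set
  Factor μ w = ∃ λ v → ∃ λ v' → w ≡ v ++ (μ ++ v')

  record Portal : Set where
    constructor portal
    field
      s    : Fin nQ
      x    : ℤp
      t    : Fin nQ
      y    : ℤp
      scc  : SameSCC A s t

  InL : Portal → PWord → Set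
  InL P w = ∃ λ u → Run A s u t × ((toℕ x + length u) mod p ≡ y) × (w ≡ ⟨ x ∶ u ⟩)
    where open Portal P

  BlockingFor : PWord → Portal → Set
  BlockingFor μ P = ¬ (∃ λ w → InL P w × Factor μ w)

  -- an SCC-path  P₀ -a₁-> P₁ ⋯ -a_k-> P_k  is given by P₀ and the list of
  -- steps (a₁,P₁) ⋯ (a_k,P_k); WellFormed checks the side conditions
  Step : Set
  Step = Fin nΣ × Portal

  WellFormed : Portal → List Step → Set
  WellFormed P [] = ⊤
  WellFormed P ((a , P') ∷ rest) =
    (Portal.x P' ≡ suc-p (Portal.y P)) ×
    (δ (Portal.t P) a (Portal.s P') ≡ true) ×
    (_<A_ A (Portal.t P) (Portal.s P')) ×
    WellFormed P' rest

  InLPath : Portal → List Step → PWord → Set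
  InLPath P [] w = InL P w
  InLPath P ((a , P') ∷ rest) w =
    ∃ λ w₀ → ∃ λ w' → InL P w₀ × InLPath P' rest w' × (w ≡ w₀ ++ ((Portal.y P , a) ∷ w'))

  lastPortal : Portal → List Step → Portal
  lastPortal P [] = P
  lastPortal P ((a , P') ∷ rest) = lastPortal P' rest

  portals : Portal → List Step → List Portal
  portals P [] = P ∷ []
  portals P ((a , P') ∷ rest) = P ∷ portals P' rest

  Accepting : Portal → List Step → Set
  Accepting P₀ steps =
    WellFormed P₀ steps ×
    (Portal.x P₀ ≡ 0 mod p) ×
    (Portal.s P₀ ≡ q₀) ×
    (F (Portal.t (lastPortal P₀ steps)) ≡ true) ×
    (∃ λ w → InLPath P₀ steps w)

  -- indices i₀ ≤ ⋯ ≤ i_k into μ with μ_{i_j} blocking for P_j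
  -- (BlocksFrom μ i Ps : the remaining indices are all ≥ i)
  BlocksFrom : (μ : List PWord) → ℕ → List Portal → Set
  BlocksFrom μ i [] = ⊤
  BlocksFrom μ i (P ∷ Ps) =
    Σ (Fin (length μ)) λ j → (i ≤ toℕ j) × BlockingFor (lookup μ j) P × BlocksFrom μ (toℕ j) Ps

  BlockingForPath : List PWord → Portal → List Step → Set
  BlockingForPath μ P₀ steps = BlocksFrom μ 0 (portals P₀ steps)

  BlockingForA : List PWord → Set
  BlockingForA μ = All IsPositional μ ×
    (∀ P₀ steps → Accepting P₀ steps → BlockingForPath μ P₀ steps)

  EmbedFrom : List PWord → (μ' : List PWord) → ℕ → Set
  EmbedFrom [] μ' i = ⊤
  EmbedFrom (m ∷ ms) μ' i =
    Σ (Fin (length μ')) λ j → (i ≤ toℕ j) × Factor m (lookup μ' j) × EmbedFrom ms μ' (suc (toℕ j))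

  _⊴_ : List PWord → List PWord → Set
  μ ⊴ μ' = EmbedFrom μ μ' 0

  MinimalBlocking : List PWord → Set
  MinimalBlocking μ = BlockingForA μ ×
    (∀ μ' → BlockingForA μ' → μ' ⊴ μ → μ ⊴ μ')

-- For a portal key c = (s, x, t, y) let rank c be the least index r such that every prefix of
-- an accepting SCC-path ending in a portal of key c is blocked inside μ₀ ⋯ μ_r.  Accepting paths
-- can be cut and reglued at two portals with the same key.  Hence rank never decreases along an
-- accepting path, and μ_{rank c} itself blocks the portal ending each such prefix, since otherwise
-- all of them would already be blocked inside μ₀ ⋯ μ_{r-1}.  So the ranks alone block every
-- accepting path.  There are at most p²|Q|² keys, so if μ were longer, deleting an index that is
-- no rank would leave a blocking sequence strictly ⊴-below μ.  Ranks are least elements of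
-- undecidable predicates; since the goal is a contradiction, excluded middle for the finitely
-- many propositions involved is available under ¬¬.
module Submission where

open import Defs
open import Data.Bool using (true)
open import Data.Fin using (Fin; zero; suc; toℕ; fromℕ; fromℕ<; combine; _≟_)
open import Data.Fin.Properties
  using (toℕ-injective; toℕ<n; toℕ-fromℕ<; ≤fromℕ; combine-injective;
         all?; any?; ¬∀⟶∃¬; injective⇒≤)
open import Data.List using (List; []; _∷_; _++_; [_]; length; lookup; map; removeAt)
open import Data.List.Properties using (++-assoc; ++-identityʳ; map-++; length-removeAt′)
open import Data.List.Relation.Unary.All using (All; []; _∷_)
open import Data.List.Relation.Unary.All.Properties using (++⁺; ++⁻)
open import Data.Nat using (ℕ; zero; suc; pred; _+_; _*_; _^_; _≤_; _<_; z≤n; s≤s; NonZero)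
open import Data.Nat.Properties
  using (≤-refl; ≤-reflexive; ≤-trans; ≤-<-trans; <⇒≱; ≤∧≢⇒<; <⇒≤pred; ≮⇒≥; pred[n]≤n;
         +-suc; +-identityʳ; +-monoʳ-≤)
open import Data.Nat.DivMod using (_mod_)
open import Data.Nat.Solver using (module +-*-Solver)
open import Data.Product using (Σ; ∃; _×_; _,_; proj₁; proj₂)
open import Data.Unit using (⊤; tt)
open import Function using (_∘_)
open import Function.Definitions using (Injective)
open import Relation.Binary.PropositionalEquality hiding ([_])
open import Relation.Nullary using (¬_; Dec; yes; no; contradiction)
open import Relation.Nullary.Decidable using (¬¬-excluded-middle)
open import Relation.Unary using (Decidable)

¬¬-∀-Fin : ∀ n {P : Fin n → Set} → (∀ i → ¬ ¬ P i) → ¬ ¬ (∀ i → P i)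
¬¬-∀-Fin zero    _ k = k λ ()
¬¬-∀-Fin (suc n) h k =
  h zero λ P₀ → ¬¬-∀-Fin n (h ∘ suc) λ P₊ → k λ { zero → P₀ ; (suc i) → P₊ i }

least : ∀ {n} {P : Fin n → Set} → Decidable P → ∃ P →
        ∃ λ i → P i × (∀ j → P j → toℕ i ≤ toℕ j)
least {suc n} P? _ with P? zero
... | yes P₀ = zero , P₀ , λ _ _ → z≤n
least {suc n} P? (zero , P₀)  | no ¬P₀ = contradiction P₀ ¬P₀
least {suc n} P? (suc i , Pᵢ) | no ¬P₀ with least (P? ∘ suc) (i , Pᵢ)
... | j , Pⱼ , minimal =
  suc j , Pⱼ , λ { zero P₀ → contradiction P₀ ¬P₀ ; (suc k) Pₖ → s≤s (minimal k Pₖ) }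

∃-∉-image : ∀ {m n} → m < n → (f : Fin m → Fin n) → ∃ λ i → ∀ c → f c ≢ i
∃-∉-image {m} {n} m<n f with all? (λ i → any? (λ c → f c ≟ i))
... | yes onto = contradiction (injective⇒≤ section-injective) (<⇒≱ m<n)
  where
  section-injective : Injective _≡_ _≡_ (proj₁ ∘ onto)
  section-injective {i} {j} eq = trans (sym (proj₂ (onto i))) (trans (cong f eq) (proj₂ (onto j)))
... | no ¬onto with ¬∀⟶∃¬ n _ (λ i → any? (λ c → f c ≟ i)) ¬onto
...   | i , unhit = i , λ c eq → unhit (c , eq)

m<n⇒pred[n]<n : ∀ {m n} → m < n → pred n < n
m<n⇒pred[n]<n (s≤s _) = ≤-refl

module _ {a} {A : Set a} where

  punchOut-removeAt : (xs : List A) (i j : Fin (length xs)) → i ≢ j → Fin (length (removeAt xs i))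
  punchOut-removeAt (x ∷ xs) zero    zero    i≢j = contradiction refl i≢j
  punchOut-removeAt (x ∷ xs) zero    (suc j) _   = j
  punchOut-removeAt (x ∷ xs) (suc i) zero    _   = zero
  punchOut-removeAt (x ∷ xs) (suc i) (suc j) i≢j = suc (punchOut-removeAt xs i j (i≢j ∘ cong suc))

  lookup-punchOut-removeAt : ∀ xs i j (i≢j : i ≢ j) →
    lookup (removeAt xs i) (punchOut-removeAt xs i j i≢j) ≡ lookup xs j
  lookup-punchOut-removeAt (x ∷ xs) zero    zero    i≢j = contradiction refl i≢j
  lookup-punchOut-removeAt (x ∷ xs) zero    (suc j) _   = refl
  lookup-punchOut-removeAt (x ∷ xs) (suc i) zero    _   = refl
  lookup-punchOut-removeAt (x ∷ xs) (suc i) (suc j) i≢j = lookup-punchOut-removeAt xs i j _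

  punchOut-removeAt-mono : ∀ xs i j k (i≢j : i ≢ j) (i≢k : i ≢ k) → toℕ j ≤ toℕ k →
    toℕ (punchOut-removeAt xs i j i≢j) ≤ toℕ (punchOut-removeAt xs i k i≢k)
  punchOut-removeAt-mono (x ∷ xs) zero    zero    _       i≢j _   _         = contradiction refl i≢j
  punchOut-removeAt-mono (x ∷ xs) zero    (suc j) zero    _   i≢k _         = contradiction refl i≢k
  punchOut-removeAt-mono (x ∷ xs) zero    (suc j) (suc k) _   _   (s≤s j≤k) = j≤k
  punchOut-removeAt-mono (x ∷ xs) (suc i) zero    _       _   _   _         = z≤n
  punchOut-removeAt-mono (x ∷ xs) (suc i) (suc j) (suc k) _   _   (s≤s j≤k) =
    s≤s (punchOut-removeAt-mono xs i j k _ _ j≤k)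

  All-removeAt⁺ : ∀ {ℓ} {P : A → Set ℓ} xs i → All P xs → All P (removeAt xs i)
  All-removeAt⁺ (x ∷ xs) zero    (_ ∷ pxs)  = pxs
  All-removeAt⁺ (x ∷ xs) (suc i) (px ∷ pxs) = px ∷ All-removeAt⁺ xs i pxs

module _ (A : NFA) (p : ℕ) .{{_ : NonZero p}} where
  open NFA A

  Key : Set
  Key = Fin (nQ * p * nQ * p)

  corners : Portal A p → Fin nQ × Fin p × Fin nQ × Fin p
  corners (portal s x t y _) = s , x , t , y

  key : Portal A p → Key
  key (portal s x t y _) = combine (combine (combine s x) t) y

  key-injective : ∀ P Q → key P ≡ key Q → corners P ≡ corners Q
  key-injective (portal s x t y _) (portal s′ x′ t′ y′ _) eq
    with combine-injective (combine (combine s x) t) y (combine (combine s′ x′) t′) y′ eq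
  ... | eq₃ , refl with combine-injective (combine s x) t (combine s′ x′) t′ eq₃
  ...   | eq₂ , refl with combine-injective s x s′ x′ eq₂
  ...     | refl , refl = refl

  BlockingFor-resp : ∀ {w} P Q → key P ≡ key Q → BlockingFor A p w P → BlockingFor A p w Q
  BlockingFor-resp P@(portal _ _ _ _ _) Q@(portal _ _ _ _ _) eq blocks with key-injective P Q eq
  ... | refl = blocks

  EmbedFrom-∷ : ∀ {ms ys a} y → EmbedFrom A p ms ys a → EmbedFrom A p ms (y ∷ ys) (suc a)
  EmbedFrom-∷ {[]}     y _                  = tt
  EmbedFrom-∷ {m ∷ ms} y (j , a≤j , m⊑ , e) = suc j , s≤s a≤j , m⊑ , EmbedFrom-∷ y e

  EmbedFrom-weaken : ∀ {ms ys a b} → a ≤ b → EmbedFrom A p ms ys b → EmbedFrom A p ms ys a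
  EmbedFrom-weaken {[]}     _   _                  = tt
  EmbedFrom-weaken {m ∷ ms} a≤b (j , b≤j , m⊑ , e) = j , ≤-trans a≤b b≤j , m⊑ , e

  EmbedFrom-length : ∀ ms ys a → EmbedFrom A p ms ys a → a ≤ length ys → length ms + a ≤ length ys
  EmbedFrom-length []       ys a _               a≤ = a≤
  EmbedFrom-length (m ∷ ms) ys a (j , a≤j , _ , e) _ =
    subst (_≤ length ys) (+-suc (length ms) a)
      (≤-trans (+-monoʳ-≤ (length ms) (s≤s a≤j)) (EmbedFrom-length ms ys (suc (toℕ j)) e (toℕ<n j)))

  Factor-refl : ∀ w → Factor A p w w
  Factor-refl w = [] , [] , sym (++-identityʳ w)

  ⊴-refl : ∀ ms → _⊴_ A p ms ms
  ⊴-refl []       = tt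
  ⊴-refl (m ∷ ms) = zero , z≤n , Factor-refl m , EmbedFrom-∷ m (⊴-refl ms)

  removeAt-⊴ : ∀ ms i → _⊴_ A p (removeAt ms i) ms
  removeAt-⊴ (m ∷ ms) zero    = EmbedFrom-weaken z≤n (EmbedFrom-∷ m (⊴-refl ms))
  removeAt-⊴ (m ∷ ms) (suc i) = zero , z≤n , Factor-refl m , EmbedFrom-∷ m (removeAt-⊴ ms i)

  ⋬-removeAt : ∀ ms i → ¬ _⊴_ A p ms (removeAt ms i)
  ⋬-removeAt ms i ms⊴ = <⇒≱ (≤-reflexive (sym (length-removeAt′ ms i))) long
    where
    long : length ms ≤ length (removeAt ms i)
    long = subst (_≤ length (removeAt ms i)) (+-identityʳ (length ms))
             (EmbedFrom-length ms (removeAt ms i) 0 ms⊴ z≤n)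

  MinimalBlocking⇒¬BlockingForA-removeAt : ∀ μ i → MinimalBlocking A p μ →
    ¬ BlockingForA A p (removeAt μ i)
  MinimalBlocking⇒¬BlockingForA-removeAt μ i (_ , minimal) blocking =
    ⋬-removeAt μ i (minimal (removeAt μ i) blocking (removeAt-⊴ μ i))

  lastPortal-++ : ∀ P xs ys → lastPortal A p P (xs ++ ys) ≡ lastPortal A p (lastPortal A p P xs) ys
  lastPortal-++ P []             ys = refl
  lastPortal-++ P ((_ , P′) ∷ xs) ys = lastPortal-++ P′ xs ys

  portals-∷ : ∀ P steps → portals A p P steps ≡ P ∷ map proj₂ steps
  portals-∷ P []              = refl
  portals-∷ P ((_ , P′) ∷ steps) = cong (P ∷_) (portals-∷ P′ steps)

  portals-++ : ∀ P xs ys → portals A p P (xs ++ ys) ≡ portals A p P xs ++ map proj₂ ys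
  portals-++ P xs ys = begin
    portals A p P (xs ++ ys)             ≡⟨ portals-∷ P (xs ++ ys) ⟩
    P ∷ map proj₂ (xs ++ ys)             ≡⟨ cong (P ∷_) (map-++ proj₂ xs ys) ⟩
    (P ∷ map proj₂ xs) ++ map proj₂ ys   ≡⟨ cong (_++ map proj₂ ys) (sym (portals-∷ P xs)) ⟩
    portals A p P xs ++ map proj₂ ys     ∎
    where open ≡-Reasoning

  WellFormed-++⁻ : ∀ P xs ys → WellFormed A p P (xs ++ ys) →
    WellFormed A p P xs × WellFormed A p (lastPortal A p P xs) ys
  WellFormed-++⁻ P []              ys wf = tt , wf
  WellFormed-++⁻ P ((_ , P′) ∷ xs) ys (x≡ , δ≡ , <A , wf) with WellFormed-++⁻ P′ xs ys wf
  ... | wf₁ , wf₂ = (x≡ , δ≡ , <A , wf₁) , wf₂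

  WellFormed-++⁺ : ∀ P xs ys → WellFormed A p P xs → WellFormed A p (lastPortal A p P xs) ys →
    WellFormed A p P (xs ++ ys)
  WellFormed-++⁺ P []              ys _                      wf₂ = wf₂
  WellFormed-++⁺ P ((_ , P′) ∷ xs) ys (x≡ , δ≡ , <A , wf₁) wf₂ =
    x≡ , δ≡ , <A , WellFormed-++⁺ P′ xs ys wf₁ wf₂

  NonEmptyL : Portal A p → Set
  NonEmptyL P = ∃ (InL A p P)

  InLPath⇒All-NonEmptyL : ∀ P steps {w} → InLPath A p P steps w →
    All NonEmptyL (portals A p P steps)
  InLPath⇒All-NonEmptyL P []              w∈ = (_ , w∈) ∷ []
  InLPath⇒All-NonEmptyL P ((_ , P′) ∷ steps) (_ , _ , w₀∈ , w′∈ , _) =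
    (_ , w₀∈) ∷ InLPath⇒All-NonEmptyL P′ steps w′∈

  All-NonEmptyL⇒InLPath : ∀ P steps → All NonEmptyL (portals A p P steps) → ∃ (InLPath A p P steps)
  All-NonEmptyL⇒InLPath P []              ((w , w∈) ∷ []) = w , w∈
  All-NonEmptyL⇒InLPath P ((a , P′) ∷ steps) ((w₀ , w₀∈) ∷ nonempty)
    with All-NonEmptyL⇒InLPath P′ steps nonempty
  ... | w′ , w′∈ = w₀ ++ (Portal.y P , a) ∷ w′ , w₀ , w′ , w₀∈ , w′∈ , refl

  AcceptingTo : Portal A p → List (Step A p) → Set
  AcceptingTo P₀ pre =
    WellFormed A p P₀ pre × (Portal.x P₀ ≡ 0 mod p) × (Portal.s P₀ ≡ q₀) ×
    All NonEmptyL (portals A p P₀ pre)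

  AcceptingFrom : Portal A p → List (Step A p) → Set
  AcceptingFrom Q post =
    WellFormed A p Q post × (F (Portal.t (lastPortal A p Q post)) ≡ true) ×
    All NonEmptyL (map proj₂ post)

  Accepting-++⁻ : ∀ P₀ pre post → Accepting A p P₀ (pre ++ post) →
    AcceptingTo P₀ pre × AcceptingFrom (lastPortal A p P₀ pre) post
  Accepting-++⁻ P₀ pre post (wf , x₀ , s₀ , final , _ , w∈)
    with WellFormed-++⁻ P₀ pre post wf
       | ++⁻ (portals A p P₀ pre)
           (subst (All NonEmptyL) (portals-++ P₀ pre post)
             (InLPath⇒All-NonEmptyL P₀ (pre ++ post) w∈))
  ... | wf₁ , wf₂ | ne₁ , ne₂ =
    (wf₁ , x₀ , s₀ , ne₁) ,
    (wf₂ , subst (λ R → F (Portal.t R) ≡ true) (lastPortal-++ P₀ pre post) final , ne₂)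

  Accepting-++⁺ : ∀ P₀ pre post → AcceptingTo P₀ pre → AcceptingFrom (lastPortal A p P₀ pre) post →
    Accepting A p P₀ (pre ++ post)
  Accepting-++⁺ P₀ pre post (wf₁ , x₀ , s₀ , ne₁) (wf₂ , final , ne₂) =
    WellFormed-++⁺ P₀ pre post wf₁ wf₂ , x₀ , s₀ ,
    subst (λ R → F (Portal.t R) ≡ true) (sym (lastPortal-++ P₀ pre post)) final ,
    All-NonEmptyL⇒InLPath P₀ (pre ++ post)
      (subst (All NonEmptyL) (sym (portals-++ P₀ pre post)) (++⁺ ne₁ ne₂))

  AcceptingFrom-resp : ∀ Q Q′ post → key Q ≡ key Q′ → AcceptingFrom Q post → AcceptingFrom Q′ post
  AcceptingFrom-resp Q@(portal _ _ _ _ _) Q′@(portal _ _ _ _ _) post eq acc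
    with key-injective Q Q′ eq
  AcceptingFrom-resp (portal _ _ _ _ _) (portal _ _ _ _ _) []      _ acc | refl = acc
  AcceptingFrom-resp (portal _ _ _ _ _) (portal _ _ _ _ _) (_ ∷ _) _ acc | refl = acc

  record Occurrence : Set where
    constructor occurrence
    field
      start     : Portal A p
      before    : List (Step A p)
      after     : List (Step A p)
      accepting : Accepting A p start (before ++ after)

    here : Portal A p
    here = lastPortal A p start before

  open Occurrence

  splice : (o o′ : Occurrence) → key (here o) ≡ key (here o′) → Occurrence
  splice o o′ eq = occurrence (start o) (before o) (after o′)
    (Accepting-++⁺ (start o) (before o) (after o′)
      (proj₁ (Accepting-++⁻ (start o) (before o) (after o) (accepting o)))
      (AcceptingFrom-resp (here o′) (here o) (after o′) (sym eq)
        (proj₂ (Accepting-++⁻ (start o′) (before o′) (after o′) (accepting o′)))))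

  advance : ∀ P₀ pre s post → Accepting A p P₀ (pre ++ s ∷ post) → Occurrence
  advance P₀ pre s post acc =
    occurrence P₀ (pre ++ [ s ]) post (subst (Accepting A p P₀) (sym (++-assoc pre [ s ] post)) acc)

  here-advance : ∀ P₀ pre b P′ post acc → here (advance P₀ pre (b , P′) post acc) ≡ P′
  here-advance P₀ pre b P′ post _ = lastPortal-++ P₀ pre [ b , P′ ]

  module _ (μ : List (PWord A p)) where

    BlocksUpTo : ℕ → ℕ → List (Portal A p) → Set
    BlocksUpTo a u []       = ⊤
    BlocksUpTo a u (P ∷ Ps) =
      Σ (Fin (length μ)) λ j →
        a ≤ toℕ j × toℕ j ≤ u × BlockingFor A p (lookup μ j) P × BlocksUpTo (toℕ j) u Ps

    PrefixBlocked : Key → ℕ → Set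
    PrefixBlocked c u =
      (o : Occurrence) → key (here o) ≡ c → BlocksUpTo 0 u (portals A p (start o) (before o))

    BlocksFrom⇒BlocksUpTo : ∀ {a u} Ps → (∀ (j : Fin (length μ)) → toℕ j ≤ u) →
      BlocksFrom A p μ a Ps → BlocksUpTo a u Ps
    BlocksFrom⇒BlocksUpTo []       _ _                        = tt
    BlocksFrom⇒BlocksUpTo (P ∷ Ps) ≤u (j , a≤j , blocks , bs) =
      j , a≤j , ≤u j , blocks , BlocksFrom⇒BlocksUpTo Ps ≤u bs

    BlocksUpTo-mono : ∀ {a u u′} Ps → u ≤ u′ → BlocksUpTo a u Ps → BlocksUpTo a u′ Ps
    BlocksUpTo-mono []       _    _                              = tt
    BlocksUpTo-mono (P ∷ Ps) u≤u′ (j , a≤j , j≤u , blocks , bs) =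
      j , a≤j , ≤-trans j≤u u≤u′ , blocks , BlocksUpTo-mono Ps u≤u′ bs

    BlocksUpTo-++⁻ˡ : ∀ {a u} Ps Qs → BlocksUpTo a u (Ps ++ Qs) → BlocksUpTo a u Ps
    BlocksUpTo-++⁻ˡ []       _  _                              = tt
    BlocksUpTo-++⁻ˡ (P ∷ Ps) Qs (j , a≤j , j≤u , blocks , bs) =
      j , a≤j , j≤u , blocks , BlocksUpTo-++⁻ˡ Ps Qs bs

    BlocksUpTo-portals-++⁻ : ∀ {a u} P pre post →
      BlocksUpTo a u (portals A p P (pre ++ post)) → BlocksUpTo a u (portals A p P pre)
    BlocksUpTo-portals-++⁻ P pre post bs =
      BlocksUpTo-++⁻ˡ (portals A p P pre) _ (subst (BlocksUpTo _ _) (portals-++ P pre post) bs)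

    BlocksUpTo-portals-≤ : ∀ {a u} P pre → BlocksUpTo a u (portals A p P pre) → a ≤ u
    BlocksUpTo-portals-≤ P []      (_ , a≤j , j≤u , _) = ≤-trans a≤j j≤u
    BlocksUpTo-portals-≤ P (_ ∷ _) (_ , a≤j , j≤u , _) = ≤-trans a≤j j≤u

    BlocksUpTo-last : ∀ {a u} P pre → BlocksUpTo a u (portals A p P pre) →
      ∃ λ j → toℕ j ≤ u × BlockingFor A p (lookup μ j) (lastPortal A p P pre) ×
              BlocksUpTo a (toℕ j) (portals A p P pre)
    BlocksUpTo-last P [] (j , a≤j , j≤u , blocks , _) =
      j , j≤u , blocks , j , a≤j , ≤-refl , blocks , tt
    BlocksUpTo-last P ((_ , P′) ∷ pre) (j , a≤j , j≤u , blocks , bs) with BlocksUpTo-last P′ pre bs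
    ... | k , k≤u , blocksₖ , bs′ =
      k , k≤u , blocksₖ , j , a≤j , BlocksUpTo-portals-≤ P′ pre bs′ , blocks , bs′

  module Ranking (μ : List (PWord A p))
                 (last : Fin (length μ)) (≤last : ∀ (j : Fin (length μ)) → toℕ j ≤ toℕ last)
                 (blocking : BlockingForA A p μ)
                 (decide : ∀ c (i : Fin (length μ)) → Dec (PrefixBlocked μ c (toℕ i))) where

    PrefixBlocked-last : ∀ c → PrefixBlocked μ c (toℕ last)
    PrefixBlocked-last c o _ =
      BlocksUpTo-portals-++⁻ μ (start o) (before o) (after o)
        (BlocksFrom⇒BlocksUpTo μ (portals A p (start o) (before o ++ after o)) ≤last
          (proj₂ blocking (start o) (before o ++ after o) (accepting o)))

    rank : Key → Fin (length μ)
    rank c = proj₁ (least (decide c) (last , PrefixBlocked-last c))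

    rank-PrefixBlocked : ∀ c → PrefixBlocked μ c (toℕ (rank c))
    rank-PrefixBlocked c = proj₁ (proj₂ (least (decide c) (last , PrefixBlocked-last c)))

    rank-minimal : ∀ c j → PrefixBlocked μ c (toℕ j) → toℕ (rank c) ≤ toℕ j
    rank-minimal c = proj₂ (proj₂ (least (decide c) (last , PrefixBlocked-last c)))

    below-rank : ∀ {c} Q → key Q ≡ c → ¬ BlockingFor A p (lookup μ (rank c)) Q →
      (o : Occurrence) → key (here o) ≡ c →
      ∃ λ j → toℕ j < toℕ (rank c) × BlocksUpTo μ 0 (toℕ j) (portals A p (start o) (before o))
    below-rank {c} Q keyQ unblocked o keyₒ
      with BlocksUpTo-last μ (start o) (before o) (rank-PrefixBlocked c o keyₒ)
    ... | j , j≤rank , blocks , bs = j , ≤∧≢⇒< j≤rank j≢rank , bs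
      where
      j≢rank : toℕ j ≢ toℕ (rank c)
      j≢rank eq = unblocked (subst (λ k → BlockingFor A p (lookup μ k) Q) (toℕ-injective eq)
                    (BlockingFor-resp (here o) Q (trans keyₒ (sym keyQ)) blocks))

    rank-blocks : (o : Occurrence) → BlockingFor A p (lookup μ (rank (key (here o)))) (here o)
    rank-blocks o unblocked = <⇒≱ (m<n⇒pred[n]<n (proj₁ (proj₂ (below o refl)))) rank≤pred
      where
      c = key (here o)
      r = toℕ (rank c)
      below = below-rank (here o) refl (λ blocks → blocks unblocked)
      pred<length : pred r < length μ
      pred<length = ≤-<-trans pred[n]≤n (toℕ<n (rank c))
      prefixBlocked : PrefixBlocked μ c (toℕ (fromℕ< pred<length))
      prefixBlocked o′ keyₒ′ with below o′ keyₒ′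
      ... | j , j<r , bs rewrite toℕ-fromℕ< pred<length =
        BlocksUpTo-mono μ (portals A p (start o′) (before o′)) (<⇒≤pred j<r) bs
      rank≤pred : r ≤ pred r
      rank≤pred = subst (r ≤_) (toℕ-fromℕ< pred<length) (rank-minimal c _ prefixBlocked)

    rank-mono : ∀ P₀ pre b P′ post → Accepting A p P₀ (pre ++ (b , P′) ∷ post) →
      toℕ (rank (key (lastPortal A p P₀ pre))) ≤
      toℕ (rank (key (lastPortal A p P₀ (pre ++ [ b , P′ ]))))
    rank-mono P₀ pre b P′ post acc = rank-minimal _ _ prefixBlocked
      where
      c′ = key (lastPortal A p P₀ (pre ++ [ b , P′ ]))
      prefixBlocked : PrefixBlocked μ (key (lastPortal A p P₀ pre)) (toℕ (rank c′))
      prefixBlocked o keyₒ =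
        BlocksUpTo-portals-++⁻ μ (start o) (before o) [ b , P′ ]
          (rank-PrefixBlocked c′ (advance (start o) (before o) (b , P′) post acc′) key-advance)
        where
        acc′ = accepting (splice o (occurrence P₀ pre ((b , P′) ∷ post) acc) keyₒ)
        key-advance : key (here (advance (start o) (before o) (b , P′) post acc′)) ≡ c′
        key-advance = cong key (trans (here-advance (start o) (before o) b P′ post acc′)
                                      (sym (lastPortal-++ P₀ pre [ b , P′ ])))

    module _ (i : Fin (length μ)) (unranked : ∀ c → rank c ≢ i) where

      index′ : Portal A p → Fin (length (removeAt μ i))
      index′ Q = punchOut-removeAt μ i (rank (key Q)) (unranked (key Q) ∘ sym)

      index′-blocks : (o : Occurrence) →
        BlockingFor A p (lookup (removeAt μ i) (index′ (here o))) (here o)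
      index′-blocks o = subst (λ w → BlockingFor A p w (here o))
                          (sym (lookup-punchOut-removeAt μ i _ _)) (rank-blocks o)

      BlocksFrom-removeAt : ∀ P₀ pre post → Accepting A p P₀ (pre ++ post) →
        ∀ {a} → a ≤ toℕ (index′ (lastPortal A p P₀ pre)) →
        BlocksFrom A p (removeAt μ i) a (portals A p (lastPortal A p P₀ pre) post)
      BlocksFrom-removeAt P₀ pre [] acc a≤ =
        index′ (lastPortal A p P₀ pre) , a≤ , index′-blocks (occurrence P₀ pre [] acc) , tt
      BlocksFrom-removeAt P₀ pre ((b , P′) ∷ post) acc a≤ =
        index′ Q , a≤ , index′-blocks (occurrence P₀ pre _ acc) ,
        subst (λ R → BlocksFrom A p (removeAt μ i) (toℕ (index′ Q)) (portals A p R post))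
          (here-advance P₀ pre b P′ post acc)
          (BlocksFrom-removeAt P₀ (pre ++ [ b , P′ ]) post
            (accepting (advance P₀ pre (b , P′) post acc))
            (punchOut-removeAt-mono μ i _ _ _ _ (rank-mono P₀ pre b P′ post acc)))
        where Q = lastPortal A p P₀ pre

      BlockingForA-removeAt : BlockingForA A p (removeAt μ i)
      BlockingForA-removeAt =
        All-removeAt⁺ μ i (proj₁ blocking) ,
        λ P₀ steps acc → BlocksFrom-removeAt P₀ [] steps acc z≤n

  long⇒¬MinimalBlocking : ∀ μ → nQ * p * nQ * p < length μ → ¬ MinimalBlocking A p μ
  long⇒¬MinimalBlocking []       ()
  long⇒¬MinimalBlocking (m ∷ ms) long minimal =
    ¬¬-∀-Fin _ (λ c → ¬¬-∀-Fin _ (λ i → ¬¬-excluded-middle)) λ decide →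
      let open Ranking (m ∷ ms) (fromℕ (length ms)) ≤fromℕ (proj₁ minimal) decide
          i , unranked = ∃-∉-image long rank
      in MinimalBlocking⇒¬BlockingForA-removeAt (m ∷ ms) i minimal
           (BlockingForA-removeAt i unranked)

keys-count : ∀ n q → n * q * n * q ≡ q ^ 2 * n ^ 2
keys-count = solve 2 (λ n q → n :* q :* n :* q := (q :^ 2) :* (n :^ 2)) refl
  where open +-*-Solver

lemma54 : (A : NFA) → Trim A →
    (p : ℕ) .{{_ : NonZero p}} → IsCycleLcm A p →
    (μ : List (PWord A p)) → MinimalBlocking A p μ →
    length μ ≤ (p ^ 2) * (NFA.nQ A ^ 2)
lemma54 A _ p _ μ minimal =
  subst (length μ ≤_) (keys-count (NFA.nQ A) p)
    (≮⇒≥ λ long → long⇒¬MinimalBlocking A p μ long minimal)
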